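{- For every pair of finite simple graphs $G,H$, the complexes $\mathsf{B}_0(G*H)$ and $\mathsf{B}_0(G)*\mathsf{B}_0(H)$ are $\mathbb{Z}_2$-homeomorphic.
   Context: The join $G*H$ of graphs is obtained from disjoint copies of $G$ and $H$ by adding all edges between a vertex of $G$ and a vertex of $H$. The join $\mathsf{K}*\mathsf{L}$ of simplicial complexes has vertex set $V(\mathsf{K})\uplus V(\mathsf{L})$ and simplices $A\uplus B$ with $A\in\mathsf{K}$, $B\in\mathsf{L}$. For a graph $G$, $\mathsf{B}_0(G)$ is the simplicial complex on $\{+v,-v : v\in V(G)\}$ whose simplices are $\{+v: v\in A'\}\cup\{ -v: v\in A''\}$ with $A',A''\subseteq V(G)$ disjoint and every vertex of $A'$ adjacent to every vertex of $A''$ (parts may be empty). $\mathbb{Z}_2$ acts on $\mathsf{B}_0(G)$ by $+v\leftrightarrow -v$, and on a join by acting on both factors. A $\mathbb{Z}_2$-homeomorphism is a homeomorphism commuting with the $\mathbb{Z}_2$-actions. -}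

module Defs where

open import Data.Bool using (Bool; true; false)
open import Data.Fin using (Fin)
open import Data.Nat using (ℕ)
open import Data.Product using (_×_; _,_; Σ)
open import Data.Sum using (_⊎_; inj₁; inj₂)
open import Data.Empty using (⊥)
open import Data.Unit using (⊤)
open import Relation.Nullary using (¬_)
open import Relation.Binary.PropositionalEquality using (_≡_)
open import Function using (_∘_)
open import Function.Bundles using (_↔_; _⇔_; Inverse)

record SimpleGraph (V : Set) : Set₁ where
  field
    Adj    : V → V → Set
    sym    : ∀ {u v} → Adj u v → Adj v u
    irrefl : ∀ {v} → ¬ Adj v v
open SimpleGraph public

JoinAdj : ∀ {V W} → SimpleGraph V → SimpleGraph W → V ⊎ W → V ⊎ W → Set
JoinAdj G H (inj₁ u) (inj₁ v) = Adj G u v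
JoinAdj G H (inj₁ u) (inj₂ v) = ⊤
JoinAdj G H (inj₂ u) (inj₁ v) = ⊤
JoinAdj G H (inj₂ u) (inj₂ v) = Adj H u v

joinSym : ∀ {V W} (G : SimpleGraph V) (H : SimpleGraph W) {x y} →
          JoinAdj G H x y → JoinAdj G H y x
joinSym G H {inj₁ u} {inj₁ v} a = sym G a
joinSym G H {inj₁ u} {inj₂ v} a = _
joinSym G H {inj₂ u} {inj₁ v} a = _
joinSym G H {inj₂ u} {inj₂ v} a = sym H a

joinIrrefl : ∀ {V W} (G : SimpleGraph V) (H : SimpleGraph W) {x} →
             ¬ JoinAdj G H x x
joinIrrefl G H {inj₁ u} = irrefl G
joinIrrefl G H {inj₂ u} = irrefl H

_*ᴳ_ : ∀ {V W} → SimpleGraph V → SimpleGraph W → SimpleGraph (V ⊎ W)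
G *ᴳ H = record { Adj = JoinAdj G H ; sym = λ {x} {y} → joinSym G H {x} {y} ; irrefl = λ {x} → joinIrrefl G H {x} }

-- A vertex subset is given by its characteristic function V → Bool
-- (all vertex types used here are finite, so all subsets are finite).
record Z2Complex : Set₁ where
  field
    Vert      : Set
    IsSimplex : (Vert → Bool) → Set
    ν         : Vert → Vert
open Z2Complex public

-- B₀(G): vertices ±v, encoded as (true , v) = +v and (false , v) = -v.
-- Simplices: {+v : v ∈ A'} ∪ {-v : v ∈ A''} with A', A'' disjoint and
-- every vertex of A' adjacent to every vertex of A''.
B0Simplex : ∀ {V} → SimpleGraph V → (Bool × V → Bool) → Set
B0Simplex {V} G σ =
  (∀ (v : V) → σ (true , v) ≡ true → σ (false , v) ≡ true → ⊥) ×
  (∀ (u v : V) → σ (true , u) ≡ true → σ (false , v) ≡ true → Adj G u v)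

flip± : ∀ {V : Set} → Bool × V → Bool × V
flip± (true , v) = false , v
flip± (false , v) = true , v

B0 : ∀ {V} → SimpleGraph V → Z2Complex
B0 {V} G = record { Vert = Bool × V ; IsSimplex = B0Simplex G ; ν = flip± }

joinν : ∀ (K L : Z2Complex) → Vert K ⊎ Vert L → Vert K ⊎ Vert L
joinν K L (inj₁ x) = inj₁ (ν K x)
joinν K L (inj₂ y) = inj₂ (ν L y)

_*ᶜ_ : Z2Complex → Z2Complex → Z2Complex
K *ᶜ L = record
  { Vert = Vert K ⊎ Vert L
  ; IsSimplex = λ σ → IsSimplex K (σ ∘ inj₁) × IsSimplex L (σ ∘ inj₂)
  ; ν = joinν K L }

record Z2Iso (K L : Z2Complex) : Set₁ where
  field
    bij       : Vert K ↔ Vert L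
    simplices : ∀ (σ : Vert K → Bool) →
                IsSimplex K σ ⇔ IsSimplex L (σ ∘ Inverse.from bij)
    equivar   : ∀ (x : Vert K) → Inverse.to bij (ν K x) ≡ ν L (Inverse.to bij x)

{-# OPTIONS --safe #-}
-- In G * H every vertex of G is adjacent to every vertex of H, so the
-- condition defining B₀(G * H) is vacuous on the mixed pairs (+u, −w) and
-- (+w, −u) with u ∈ G, w ∈ H.  What remains is exactly the conjunction of the
-- conditions for B₀(G) and B₀(H), so the vertex bijection ±(inj x) ↦ inj (±x)
-- is a Z₂-equivariant simplicial isomorphism.
module Submission where

open import Defs
open import Data.Nat using (ℕ)
open import Data.Fin using (Fin)
open import Data.Bool using (Bool; true; false)
open import Data.Empty using (⊥)
open import Data.Product using (_×_; _,_)
open import Data.Product.Algebra using (×-distribˡ-⊎)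
open import Data.Sum using (_⊎_; inj₁; inj₂)
open import Function using (_∘_)
open import Function.Bundles using (_↔_; Inverse; mk⇔)
open import Level using (0ℓ)
open import Relation.Binary.PropositionalEquality using (_≡_; refl)

module _ {V W : Set} (G : SimpleGraph V) (H : SimpleGraph W) where

  signed-⊎↔⊎-signed : (Bool × (V ⊎ W)) ↔ (Bool × V ⊎ Bool × W)
  signed-⊎↔⊎-signed = ×-distribˡ-⊎ 0ℓ Bool V W

  open Inverse signed-⊎↔⊎-signed using (to; from)

  B0-join⇒join-B0 : ∀ σ → IsSimplex (B0 (G *ᴳ H)) σ →
                    IsSimplex (B0 G *ᶜ B0 H) (σ ∘ from)
  B0-join⇒join-B0 σ (disjoint , adjacent) =
    ((disjoint ∘ inj₁) , λ u v → adjacent (inj₁ u) (inj₁ v)) ,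
    ((disjoint ∘ inj₂) , λ u v → adjacent (inj₂ u) (inj₂ v))

  join-B0⇒B0-join : ∀ σ → IsSimplex (B0 G *ᶜ B0 H) (σ ∘ from) →
                    IsSimplex (B0 (G *ᴳ H)) σ
  join-B0⇒B0-join σ ((disjointᴳ , adjacentᴳ) , (disjointᴴ , adjacentᴴ)) =
    disjoint , adjacent
    where
    disjoint : ∀ x → σ (true , x) ≡ true → σ (false , x) ≡ true → ⊥
    disjoint (inj₁ v) = disjointᴳ v
    disjoint (inj₂ w) = disjointᴴ w

    adjacent : ∀ x y → σ (true , x) ≡ true → σ (false , y) ≡ true →
               JoinAdj G H x y
    adjacent (inj₁ u) (inj₁ v) = adjacentᴳ u v
    adjacent (inj₁ _) (inj₂ _) _ _ = _
    adjacent (inj₂ _) (inj₁ _) _ _ = _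
    adjacent (inj₂ u) (inj₂ v) = adjacentᴴ u v

  to-flip± : ∀ x → to (flip± x) ≡ joinν (B0 G) (B0 H) (to x)
  to-flip± (true  , inj₁ _) = refl
  to-flip± (false , inj₁ _) = refl
  to-flip± (true  , inj₂ _) = refl
  to-flip± (false , inj₂ _) = refl

  B0-join≅join-B0 : Z2Iso (B0 (G *ᴳ H)) (B0 G *ᶜ B0 H)
  B0-join≅join-B0 = record
    { bij       = signed-⊎↔⊎-signed
    ; simplices = λ σ → mk⇔ (B0-join⇒join-B0 σ) (join-B0⇒B0-join σ)
    ; equivar   = to-flip±
    }

proposition7p3 : (n m : ℕ) (G : SimpleGraph (Fin n)) (H : SimpleGraph (Fin m)) →
    Z2Iso (B0 (G *ᴳ H)) (B0 G *ᶜ B0 H)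
proposition7p3 _ _ = B0-join≅join-B0
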